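{- Let $G$ be a bipartite graph and $X\subseteq V(G)$ with $|X|\le 3$. Then every proper precoloring of $X$ with colors from $\{1,2,3\}$ extends to a proper $3$-coloring of $G$, unless all of the following hold: (i) $X=\{x,y,z\}$ for three distinct vertices $x,y,z$; (ii) $x,y,z$ lie on the same side of the bipartition of $G$; (iii) in the precoloring, $x,y,z$ receive pairwise different colors; and (iv) every pair of vertices in $\{x,y,z\}$ has a common neighbor in $G$.
   Context: A proper precoloring of $X$ is an assignment of colors to the vertices of $X$ such that adjacent vertices of $X$ receive different colors. -}

module Defs where

open import Data.Nat using (ℕ; _≤_)
open import Data.Fin using (Fin)
open import Data.Fin.Subset using (Subset; _∈_; ∣_∣)
open import Data.Bool using (Bool; true; false)
open import Data.Product using (_×_; Σ; ∃-syntax; _,_)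
open import Data.Sum using (_⊎_)
open import Relation.Binary.PropositionalEquality using (_≡_; _≢_)
open import Relation.Nullary using (¬_)

record Graph (n : ℕ) : Set where
  field
    adj   : Fin n → Fin n → Bool
    sym   : ∀ u v → adj u v ≡ adj v u
    irrefl : ∀ v → adj v v ≡ false

open Graph public

Adj : ∀ {n} → Graph n → Fin n → Fin n → Set
Adj G u v = adj G u v ≡ true

record BipartiteGraph (n : ℕ) : Set where
  field
    graph : Graph n
    side  : Fin n → Bool
    bip   : ∀ u v → Adj graph u v → side u ≢ side v

open BipartiteGraph public

-- Colours {1,2,3} are represented by Fin 3.
Colour : Set
Colour = Fin 3

Proper3Colouring : ∀ {n} → Graph n → (Fin n → Colour) → Set
Proper3Colouring G f = ∀ u v → Adj G u v → f u ≢ f v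

-- A precolouring of X is represented by a function c : Fin n → Colour of which
-- only the values on X are relevant. It is proper if adjacent vertices of X
-- receive different colours.
ProperPrecolouring : ∀ {n} → Graph n → Subset n → (Fin n → Colour) → Set
ProperPrecolouring G X c = ∀ u v → u ∈ X → v ∈ X → Adj G u v → c u ≢ c v

Extends : ∀ {n} → Graph n → Subset n → (Fin n → Colour) → Set
Extends G X c = Σ (Fin _ → Colour) λ f →
  Proper3Colouring G f × (∀ v → v ∈ X → f v ≡ c v)

CommonNeighbour : ∀ {n} → Graph n → Fin n → Fin n → Set
CommonNeighbour G u v = ∃[ w ] (Adj G u w × Adj G v w)

Exceptional : ∀ {n} → BipartiteGraph n → Subset n → (Fin n → Colour) → Set
Exceptional B X c = ∃[ x ] ∃[ y ] ∃[ z ]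
  ( (x ≢ y × x ≢ z × y ≢ z)
  × (∀ v → (v ∈ X → (v ≡ x ⊎ v ≡ y ⊎ v ≡ z)) × ((v ≡ x ⊎ v ≡ y ⊎ v ≡ z) → v ∈ X))
  × (side B x ≡ side B y × side B y ≡ side B z)
  × (c x ≢ c y × c x ≢ c z × c y ≢ c z)
  × (CommonNeighbour (graph B) x y × CommonNeighbour (graph B) x z
     × CommonNeighbour (graph B) y z))

module Submission where

-- Write Uses s k when some vertex of X on side s of the
-- bipartition has colour k, and call side s saturated if it uses all three
-- colours.
--  * If neither side is saturated, two distinct colours α, β can be chosen so
--    that α is unused on the false side of X and β unused on the true side
--    (a counting argument: otherwise X would contain four distinct vertices).
--    Colouring every vertex outside X by α on the true side and β on the
--    false side then extends c.
--  * If side s is saturated, X consists of three vertices on side s with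
--    pairwise different colours.  As the configuration is not exceptional,
--    two of them, p and q, have no common neighbour; the third is r.  Colour
--    the vertices outside X on side s by c r, and those on the other side by
--    c q if adjacent to p and by c p otherwise.

open import Defs
open import Data.Nat using (_≤_; s≤s; z≤n)
open import Data.Nat.Properties using (≤-trans)
open import Data.Fin using (Fin; zero; suc)
open import Data.Fin.Properties using (any?; all?; ¬∀⟶∃¬) renaming (_≟_ to _≟F_)
open import Data.Fin.Subset using (Subset; ∣_∣; _∈_; _∉_; _-_)
open import Data.Fin.Subset.Properties using (_∈?_; x∈p∧x≢y⇒x∈p-y; x∈p⇒∣p-x∣<∣p∣)
open import Data.Bool using (Bool; true; false; not; if_then_else_)
open import Data.Bool.Properties using (¬-not) renaming (_≟_ to _≟B_)
open import Data.List using (List; []; _∷_; length)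
open import Data.List.Relation.Unary.All as All using (All; []; _∷_)
open import Data.List.Relation.Unary.AllPairs using ([]; _∷_)
open import Data.List.Relation.Unary.Unique.Propositional using (Unique)
open import Data.Product using (_×_; ∃-syntax; _,_)
open import Data.Sum using (_⊎_; inj₁; inj₂)
import Data.Sum as Sum
open import Data.Empty using (⊥; ⊥-elim)
open import Function using (_∘_)
open import Relation.Nullary using (¬_; Dec; yes; no)
open import Relation.Nullary.Decidable using (_×-dec_; ¬?; decidable-stable)
open import Relation.Binary.PropositionalEquality using (_≡_; _≢_; refl; trans; cong; ≢-sym) renaming (sym to ≡-sym)

-- A duplicate-free list of members of X is no longer than X: remove the head
-- from X and recurse on the tail.
distinct-members≤∣X∣ : ∀ {n} (X : Subset n) {vs : List (Fin n)} →
  Unique vs → All (_∈ X) vs → length vs ≤ ∣ X ∣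
distinct-members≤∣X∣ X {[]} [] [] = z≤n
distinct-members≤∣X∣ X {v ∷ vs} (v≢vs ∷ unique) (v∈X ∷ vs⊆X) =
  ≤-trans (s≤s (distinct-members≤∣X∣ (X - v) unique vs⊆X-v)) (x∈p⇒∣p-x∣<∣p∣ v∈X)
  where
  vs⊆X-v : All (_∈ X - v) vs
  vs⊆X-v = All.zipWith (λ (w∈X , v≢w) → x∈p∧x≢y⇒x∈p-y w∈X (≢-sym v≢w)) (vs⊆X , v≢vs)

no-four-members : ∀ {n} {X : Subset n} {a b c d : Fin n} → ∣ X ∣ ≤ 3 →
  a ∈ X → b ∈ X → c ∈ X → d ∈ X →
  a ≢ b → a ≢ c → a ≢ d → b ≢ c → b ≢ d → c ≢ d → ⊥
no-four-members {X = X} {a} {b} {c} {d} ∣X∣≤3 a∈X b∈X c∈X d∈X a≢b a≢c a≢d b≢c b≢d c≢d =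
  4≰3 (≤-trans (distinct-members≤∣X∣ X distinct (a∈X ∷ b∈X ∷ c∈X ∷ d∈X ∷ [])) ∣X∣≤3)
  where
  distinct : Unique (a ∷ b ∷ c ∷ d ∷ [])
  distinct = (a≢b ∷ a≢c ∷ a≢d ∷ []) ∷ (b≢c ∷ b≢d ∷ []) ∷ (c≢d ∷ []) ∷ [] ∷ []
  4≰3 : ¬ (4 ≤ 3)
  4≰3 (s≤s (s≤s (s≤s ())))

other-colours : (β : Colour) → ∃[ a₁ ] ∃[ a₂ ] (a₁ ≢ a₂ × a₁ ≢ β × a₂ ≢ β)
other-colours zero = suc zero , suc (suc zero) , (λ ()) , (λ ()) , (λ ())
other-colours (suc zero) = zero , suc (suc zero) , (λ ()) , (λ ()) , (λ ())
other-colours (suc (suc zero)) = zero , suc zero , (λ ()) , (λ ()) , (λ ())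

module Extension {n} (B : BipartiteGraph n) (X : Subset n) (c : Fin n → Colour)
                 (proper-on-X : ProperPrecolouring (graph B) X c) where

  G : Graph n
  G = graph B

  adj-sym : ∀ {u v} → Adj G u v → Adj G v u
  adj-sym {u} {v} u~v = trans (≡-sym (Graph.sym G u v)) u~v

  opposite-side : ∀ {u v} → Adj G u v → side B v ≡ not (side B u)
  opposite-side {u} {v} u~v = ¬-not (bip B v u (adj-sym u~v))

  colour-distinct : ∀ {u v} → c u ≢ c v → u ≢ v
  colour-distinct c-differ = c-differ ∘ cong c

  extendBy : (Fin n → Colour) → Fin n → Colour
  extendBy g v with v ∈? X
  ... | yes _ = c v
  ... | no _ = g v

  extendBy-on-X : ∀ g v → v ∈ X → extendBy g v ≡ c v
  extendBy-on-X g v v∈X with v ∈? X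
  ... | yes _ = refl
  ... | no v∉X = ⊥-elim (v∉X v∈X)

  extension-criterion : (g : Fin n → Colour) →
    (∀ u v → u ∉ X → v ∉ X → Adj G u v → g u ≢ g v) →
    (∀ u v → u ∈ X → v ∉ X → Adj G u v → c u ≢ g v) →
    Extends G X c
  extension-criterion g outside across = extendBy g , proper , extendBy-on-X g
    where
    proper : Proper3Colouring G (extendBy g)
    proper u v u~v with u ∈? X | v ∈? X
    ... | yes u∈X | yes v∈X = proper-on-X u v u∈X v∈X u~v
    ... | yes u∈X | no v∉X = across u v u∈X v∉X u~v
    ... | no u∉X | yes v∈X = ≢-sym (across v u v∈X u∉X (adj-sym u~v))
    ... | no u∉X | no v∉X = outside u v u∉X v∉X u~v

  Uses : Bool → Colour → Set
  Uses s k = ∃[ v ] (v ∈ X × side B v ≡ s × c v ≡ k)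

  uses? : ∀ s k → Dec (Uses s k)
  uses? s k = any? λ v → (v ∈? X) ×-dec ((side B v ≟B s) ×-dec (c v ≟F k))

  Saturated : Bool → Set
  Saturated s = ∀ k → Uses s k

  saturate : ∀ {s β} → Uses s β → (∀ α → α ≢ β → Uses s α) → Saturated s
  saturate {β = β} uses-β uses-others k with k ≟F β
  ... | yes refl = uses-β
  ... | no k≢β = uses-others k k≢β

  free-or-used : ∀ s β → (∃[ α ] (α ≢ β × ¬ Uses s α)) ⊎ (∀ α → α ≢ β → Uses s α)
  free-or-used s β with any? (λ α → ¬? (α ≟F β) ×-dec ¬? (uses? s α))
  ... | yes free = inj₁ free
  ... | no ¬free = inj₂ λ α α≢β → decidable-stable (uses? s α) (λ ¬uses → ¬free (α , α≢β , ¬uses))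

  -- Counting: two colours cannot both be used on both sides, since the four
  -- witnessing vertices would be pairwise distinct.
  not-used-twice-on-both-sides : ∣ X ∣ ≤ 3 → ∀ {a₁ a₂} → a₁ ≢ a₂ →
    Uses false a₁ → Uses false a₂ → Uses true a₁ → Uses true a₂ → ⊥
  not-used-twice-on-both-sides ∣X∣≤3 a₁≢a₂
    (u₁ , u₁∈X , u₁-false , cu₁) (u₂ , u₂∈X , u₂-false , cu₂)
    (v₁ , v₁∈X , v₁-true , cv₁) (v₂ , v₂∈X , v₂-true , cv₂) =
    no-four-members ∣X∣≤3 u₁∈X u₂∈X v₁∈X v₂∈X
      (colour-distinct (a₁≢a₂ ∘ same-colour cu₁ cu₂))
      (side-distinct u₁-false v₁-true) (side-distinct u₁-false v₂-true)
      (side-distinct u₂-false v₁-true) (side-distinct u₂-false v₂-true)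
      (colour-distinct (a₁≢a₂ ∘ same-colour cv₁ cv₂))
    where
    same-colour : ∀ {u v k l} → c u ≡ k → c v ≡ l → c u ≡ c v → k ≡ l
    same-colour cu cv cu≡cv = trans (≡-sym cu) (trans cu≡cv cv)
    side-distinct : ∀ {u v} → side B u ≡ false → side B v ≡ true → u ≢ v
    side-distinct u-false v-true refl with trans (≡-sym u-false) v-true
    ... | ()

  sideColour : Colour → Colour → Bool → Colour
  sideColour α β true = α
  sideColour α β false = β

  side-constant-extension : ∀ {α β} → α ≢ β → ¬ Uses false α → ¬ Uses true β →
    Extends G X c
  side-constant-extension {α} {β} α≢β α-free β-free =
    extension-criterion (sideColour α β ∘ side B) outside across
    where
    outside : ∀ u v → u ∉ X → v ∉ X → Adj G u v →
      sideColour α β (side B u) ≢ sideColour α β (side B v)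
    outside u v _ _ u~v rewrite opposite-side u~v with side B u
    ... | true = α≢β
    ... | false = ≢-sym α≢β
    across : ∀ u v → u ∈ X → v ∉ X → Adj G u v → c u ≢ sideColour α β (side B v)
    across u v u∈X _ u~v rewrite opposite-side u~v with side B u in u-side
    ... | true = λ cu≡β → β-free (u , u∈X , u-side , cu≡β)
    ... | false = λ cu≡α → α-free (u , u∈X , u-side , cu≡α)

  unsaturated-extension : ∣ X ∣ ≤ 3 → ¬ Saturated true → ¬ Saturated false →
    Extends G X c
  unsaturated-extension ∣X∣≤3 ¬sat-true ¬sat-false
    with ¬∀⟶∃¬ 3 (Uses true) (uses? true) ¬sat-true
  ... | β , β-free-true with free-or-used false β
  ...   | inj₁ (α , α≢β , α-free-false) = side-constant-extension α≢β α-free-false β-free-true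
  ...   | inj₂ others-used-false with free-or-used true β
  ...     | inj₁ (γ , γ≢β , γ-free-true) =
    side-constant-extension (≢-sym γ≢β) β-free-false γ-free-true
    where
    β-free-false : ¬ Uses false β
    β-free-false uses-β = ¬sat-false (saturate uses-β others-used-false)
  ...     | inj₂ others-used-true =
    let (a₁ , a₂ , a₁≢a₂ , a₁≢β , a₂≢β) = other-colours β in
    ⊥-elim (not-used-twice-on-both-sides ∣X∣≤3 a₁≢a₂
      (others-used-false a₁ a₁≢β) (others-used-false a₂ a₂≢β)
      (others-used-true a₁ a₁≢β) (others-used-true a₂ a₂≢β))

  Within : Fin n → Fin n → Fin n → Set
  Within x y z = ∀ v → v ∈ X → v ≡ x ⊎ v ≡ y ⊎ v ≡ z

  within-swap : ∀ {x y z} → Within x y z → Within x z y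
  within-swap within v v∈X = Sum.map₂ Sum.swap (within v v∈X)

  within-rotate : ∀ {x y z} → Within x y z → Within y z x
  within-rotate within v v∈X with within v v∈X
  ... | inj₁ v≡x = inj₂ (inj₂ v≡x)
  ... | inj₂ (inj₁ v≡y) = inj₁ v≡y
  ... | inj₂ (inj₂ v≡z) = inj₂ (inj₁ v≡z)

  module NeighbourhoodColouring {s : Bool} {p q r : Fin n}
    (within : Within p q r)
    (p-side : side B p ≡ s) (q-side : side B q ≡ s) (r-side : side B r ≡ s)
    (p≢q : c p ≢ c q) (p≢r : c p ≢ c r) (q≢r : c q ≢ c r)
    (no-common : ¬ CommonNeighbour G p q) where

    oppositeColour : Fin n → Colour
    oppositeColour v = if adj G p v then c q else c p

    oppositeColour≢r : ∀ v → oppositeColour v ≢ c r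
    oppositeColour≢r v with adj G p v
    ... | true = q≢r
    ... | false = p≢r

    colour : Fin n → Colour
    colour v with side B v ≟B s
    ... | yes _ = c r
    ... | no _ = oppositeColour v

    X-on-side-s : ∀ u → u ∈ X → side B u ≡ s
    X-on-side-s u u∈X with within u u∈X
    ... | inj₁ refl = p-side
    ... | inj₂ (inj₁ refl) = q-side
    ... | inj₂ (inj₂ refl) = r-side

    -- An edge outside X has exactly one end on side s, coloured c r.
    outside : ∀ u v → u ∉ X → v ∉ X → Adj G u v → colour u ≢ colour v
    outside u v _ _ u~v with side B u ≟B s | side B v ≟B s
    ... | yes u-s | yes v-s = ⊥-elim (bip B u v u~v (trans u-s (≡-sym v-s)))
    ... | yes _ | no _ = ≢-sym (oppositeColour≢r v)
    ... | no _ | yes _ = oppositeColour≢r u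
    ... | no u-¬s | no v-¬s = ⊥-elim (bip B u v u~v (trans (¬-not u-¬s) (≡-sym (¬-not v-¬s))))

    -- A neighbour of u ∈ X is off side s; only a neighbour of p may be
    -- coloured c q, and it cannot also be a neighbour of q.
    across : ∀ u v → u ∈ X → v ∉ X → Adj G u v → c u ≢ colour v
    across u v u∈X _ u~v with side B v ≟B s
    ... | yes v-s = ⊥-elim (bip B u v u~v (trans (X-on-side-s u u∈X) (≡-sym v-s)))
    ... | no _ with within u u∈X | adj G p v in p~v
    ...   | inj₁ refl | true = p≢q
    ...   | inj₁ refl | false with trans (≡-sym u~v) p~v
    ...     | ()
    across u v u∈X _ u~v | no _ | inj₂ (inj₁ refl) | true = λ _ → no-common (v , p~v , u~v)
    across u v u∈X _ u~v | no _ | inj₂ (inj₁ refl) | false = ≢-sym p≢q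
    across u v u∈X _ u~v | no _ | inj₂ (inj₂ refl) | true = ≢-sym q≢r
    across u v u∈X _ u~v | no _ | inj₂ (inj₂ refl) | false = ≢-sym p≢r

    extension : Extends G X c
    extension = extension-criterion colour outside across

  -- If side s is saturated, X consists of three vertices of side s with
  -- pairwise different colours; not being exceptional, two of them have no
  -- common neighbour, and the second colouring applies.
  saturated-extension : ∣ X ∣ ≤ 3 → ¬ Exceptional B X c → ∀ {s} → Saturated s →
    Extends G X c
  saturated-extension ∣X∣≤3 ¬exceptional {s} saturated
    with saturated zero | saturated (suc zero) | saturated (suc (suc zero))
  ... | x , x∈X , x-side , cx | y , y∈X , y-side , cy | z , z∈X , z-side , cz =
    by-common-neighbours (cn? x y) (cn? x z) (cn? y z)
    where
    x≢y : c x ≢ c y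
    x≢y cx≡cy with trans (≡-sym cx) (trans cx≡cy cy)
    ... | ()
    x≢z : c x ≢ c z
    x≢z cx≡cz with trans (≡-sym cx) (trans cx≡cz cz)
    ... | ()
    y≢z : c y ≢ c z
    y≢z cy≡cz with trans (≡-sym cy) (trans cy≡cz cz)
    ... | ()

    within : Within x y z
    within v v∈X with v ≟F x | v ≟F y | v ≟F z
    ... | yes v≡x | _ | _ = inj₁ v≡x
    ... | no _ | yes v≡y | _ = inj₂ (inj₁ v≡y)
    ... | no _ | no _ | yes v≡z = inj₂ (inj₂ v≡z)
    ... | no v≢x | no v≢y | no v≢z = ⊥-elim (no-four-members ∣X∣≤3 x∈X y∈X z∈X v∈X
      (colour-distinct x≢y) (colour-distinct x≢z) (≢-sym v≢x)
      (colour-distinct y≢z) (≢-sym v≢y) (≢-sym v≢z))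

    X≡xyz : ∀ v → (v ∈ X → v ≡ x ⊎ v ≡ y ⊎ v ≡ z) × (v ≡ x ⊎ v ≡ y ⊎ v ≡ z → v ∈ X)
    X≡xyz v = within v , λ where
      (inj₁ refl) → x∈X
      (inj₂ (inj₁ refl)) → y∈X
      (inj₂ (inj₂ refl)) → z∈X

    cn? : ∀ u v → Dec (CommonNeighbour G u v)
    cn? u v = any? λ w → (adj G u w ≟B true) ×-dec (adj G v w ≟B true)

    by-common-neighbours : Dec (CommonNeighbour G x y) → Dec (CommonNeighbour G x z) →
      Dec (CommonNeighbour G y z) → Extends G X c
    by-common-neighbours (yes xy) (yes xz) (yes yz) = ⊥-elim (¬exceptional
      (x , y , z , (colour-distinct x≢y , colour-distinct x≢z , colour-distinct y≢z) , X≡xyz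
      , (trans x-side (≡-sym y-side) , trans y-side (≡-sym z-side)) , (x≢y , x≢z , y≢z)
      , (xy , xz , yz)))
    by-common-neighbours (no ¬xy) _ _ = NeighbourhoodColouring.extension
      within x-side y-side z-side x≢y x≢z y≢z ¬xy
    by-common-neighbours _ (no ¬xz) _ = NeighbourhoodColouring.extension
      (within-swap within) x-side z-side y-side x≢z x≢y (≢-sym y≢z) ¬xz
    by-common-neighbours _ _ (no ¬yz) = NeighbourhoodColouring.extension
      (within-rotate within) y-side z-side x-side y≢z (≢-sym x≢y) (≢-sym x≢z) ¬yz

lemma3p4 : ∀ {n} (B : BipartiteGraph n) (X : Subset n) (c : Fin n → Colour) →
    ∣ X ∣ ≤ 3 → ProperPrecolouring (graph B) X c →
    ¬ Exceptional B X c → Extends (graph B) X c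
lemma3p4 B X c ∣X∣≤3 proper ¬exceptional =
  by-saturation (all? (uses? true)) (all? (uses? false))
  where
  open Extension B X c proper
  by-saturation : Dec (Saturated true) → Dec (Saturated false) → Extends (graph B) X c
  by-saturation (yes saturated) _ = saturated-extension ∣X∣≤3 ¬exceptional saturated
  by-saturation _ (yes saturated) = saturated-extension ∣X∣≤3 ¬exceptional saturated
  by-saturation (no ¬sat-true) (no ¬sat-false) = unsaturated-extension ∣X∣≤3 ¬sat-true ¬sat-false
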